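{- If $A$ is an $r$-by-$n$ $(0,1,\ast)$-matrix whose min-rank equals $r$, then $A$ is isolated.
   Context: A $(0,1,\ast)$-matrix has entries in $\{0,1,\ast\}$; arithmetic and ranks are over $GF_2$. A completion is obtained by replacing each $\ast$ by $0$ or $1$; the min-rank is the minimum rank of a completion. For an $r$-by-$n$ $A=(a_{ij})$, let $\mathbf{a}_i$ be the $i$th row with all stars set to $0$, and $D_i$ the diagonal $n$-by-$n$ $(0,1)$-matrix whose $j$th diagonal entry is $1$ iff $a_{ij}=\ast$. $A$ is isolated if there exist $\mathbf{z}_1,\dots,\mathbf{z}_r\in\{0,1\}^n$ such that for all $1\leq i\leq r$: $D_i\mathbf{z}_i=\mathbf{0}$, $\langle\mathbf{a}_i,\mathbf{z}_i\rangle=1$, and $\langle\mathbf{a}_j,\mathbf{z}_i\rangle=0$ for all $j<i$. -}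

module Defs where

open import Data.Bool using (Bool; true; false; _∧_; _xor_; if_then_else_)
open import Data.Nat using (ℕ; _≤_)
open import Data.Fin using (Fin; _<_)
open import Data.Product using (Σ; ∃; _×_; _,_)
open import Relation.Binary.PropositionalEquality using (_≡_)
open import Function.Definitions using (Injective)
open import Data.Unit using (⊤)

-- GF(2) is represented by Bool: addition = xor, multiplication = ∧.

data Entry : Set where
  𝟘 𝟙 ⋆ : Entry

PMatrix : ℕ → ℕ → Set
PMatrix r n = Fin r → Fin n → Entry

BMatrix : ℕ → ℕ → Set
BMatrix r n = Fin r → Fin n → Bool

Σ₂ : ∀ {n} → (Fin n → Bool) → Bool
Σ₂ {ℕ.zero} f = false
Σ₂ {ℕ.suc n} f = f Fin.zero xor Σ₂ (λ i → f (Fin.suc i))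

⟨_,_⟩ : ∀ {n} → (Fin n → Bool) → (Fin n → Bool) → Bool
⟨ x , y ⟩ = Σ₂ (λ j → x j ∧ y j)

IsCompletion : ∀ {r n} → PMatrix r n → BMatrix r n → Set
IsCompletion A C = ∀ i j → Agrees (A i j) (C i j)
  where
  Agrees : Entry → Bool → Set
  Agrees 𝟘 b = b ≡ false
  Agrees 𝟙 b = b ≡ true
  Agrees ⋆ b = ⊤

RowsIndependent : ∀ {r n k} → BMatrix r n → (Fin k → Fin r) → Set
RowsIndependent {n = n} {k = k} M s =
  (c : Fin k → Bool) →
  (∀ (j : Fin n) → Σ₂ (λ l → c l ∧ M (s l) j) ≡ false) →
  ∀ l → c l ≡ false

HasIndepRows : ∀ {r n} → BMatrix r n → ℕ → Set
HasIndepRows {r} M k =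
  Σ (Fin k → Fin r) λ s → Injective _≡_ _≡_ s × RowsIndependent M s

IsRank : ∀ {r n} → BMatrix r n → ℕ → Set
IsRank M k = HasIndepRows M k × (∀ m → HasIndepRows M m → m ≤ k)

IsMinRank : ∀ {r n} → PMatrix r n → ℕ → Set
IsMinRank {r} {n} A k =
  (Σ (BMatrix r n) λ C → IsCompletion A C × IsRank C k) ×
  (∀ (C : BMatrix r n) → IsCompletion A C → ∀ m → IsRank C m → k ≤ m)

zeroStars : ∀ {r n} → PMatrix r n → BMatrix r n
zeroStars A i j with A i j
... | 𝟙 = true
... | _ = false

-- D_i z : diagonal matrix D_i (j-th entry 1 iff a_ij = *) applied to z.
starIndicator : ∀ {r n} → PMatrix r n → Fin r → Fin n → Bool
starIndicator A i j with A i j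
... | ⋆ = true
... | _ = false

D_apply : ∀ {r n} → PMatrix r n → Fin r → (Fin n → Bool) → (Fin n → Bool)
D_apply A i z j = starIndicator A i j ∧ z j

Isolated : ∀ {r n} → PMatrix r n → Set
Isolated {r} {n} A =
  Σ (Fin r → Fin n → Bool) λ z →
    ∀ (i : Fin r) →
      (∀ j → D_apply A i (z i) j ≡ false) ×
      (⟨ zeroStars A i , z i ⟩ ≡ true) ×
      (∀ (j : Fin r) → j < i → ⟨ zeroStars A j , z i ⟩ ≡ false)

-- Fix a row i and restrict every row of the star-free matrix to the columns where row i has
-- no star. If the restricted row i were a GF(2) combination of the restricted earlier rows,
-- filling the stars of row i with that combination would give a completion with dependent rows,
-- i.e. of rank below r. Otherwise, by the Fredholm alternative over GF(2), some z vanishing on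
-- the stars of row i is orthogonal to all earlier rows but not to row i: this is z_i.
module Submission where

open import Defs
open import Algebra.Bundles using (CommutativeRing)
open import Data.Bool as Bool using (Bool; true; false; not; _∧_; _xor_)
open import Data.Bool.Properties
  using ( xor-∧-commutativeRing; ∧-assoc; ∧-comm; ∧-zeroʳ; ∧-identityʳ; ∧-inverseʳ
        ; ∧-distribʳ-xor; ∧-distribˡ-xor; xor-same; xor-identityʳ; ¬-not )
open import Data.Fin using (Fin; zero; suc; _<_; punchOut)
open import Data.Fin.Properties using (_≟_; _<?_; <-irrefl; any?; all?; punchOut-injective; injective⇒≤)
open import Data.Fin.Permutation using (Permutation; permutation)
open import Data.Nat using (ℕ; _≤_)
open import Data.Nat.Properties using (1+n≰n; ≤-pred; ≤∧≢⇒<; ≤-antisym)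
open import Data.Product using (∃; _×_; _,_; proj₁; proj₂)
open import Data.Sum using (_⊎_; inj₁; inj₂)
open import Data.Unit using (tt)
open import Data.Empty using (⊥-elim)
open import Data.Vec.Functional using (_∷_; updateAt)
open import Data.Vec.Functional.Properties using (updateAt-updates; updateAt-minimal)
open import Function.Base using (_∘_; _$_; id)
open import Function.Definitions using (Injective)
open import Relation.Binary.PropositionalEquality
open import Level using (0ℓ)
open import Relation.Binary.Definitions using (_Respects_)
open import Relation.Nullary using (Dec; does; yes; no; ¬_; ¬?; contradiction)
open import Relation.Nullary.Decidable using (decidable-stable; dec-true; dec-false; _×-dec_; _→-dec_)
open import Relation.Unary using (Pred; Decidable)

import Algebra.Properties.Semiring.Sum as SemiringSum
open SemiringSum (CommutativeRing.semiring xor-∧-commutativeRing)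
  using (sum; ∑-distrib-+; ∑-permute)

private
  variable
    k n r : ℕ

infixl 6 _⊕_
_⊕_ : (x y : Fin n → Bool) → Fin n → Bool
(x ⊕ y) j = x j xor y j

Σ₂≗sum : (f : Fin n → Bool) → Σ₂ f ≡ sum f
Σ₂≗sum {ℕ.zero}  f = refl
Σ₂≗sum {ℕ.suc n} f = cong (f zero xor_) (Σ₂≗sum (f ∘ suc))

Σ₂-cong : {f g : Fin n → Bool} → f ≗ g → Σ₂ f ≡ Σ₂ g
Σ₂-cong {ℕ.zero}  f≗g = refl
Σ₂-cong {ℕ.suc n} f≗g = cong₂ _xor_ (f≗g zero) (Σ₂-cong (f≗g ∘ suc))

Σ₂-distrib-⊕ : (f g : Fin n → Bool) → Σ₂ (f ⊕ g) ≡ Σ₂ f xor Σ₂ g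
Σ₂-distrib-⊕ f g = begin
  Σ₂ (f ⊕ g)      ≡⟨ Σ₂≗sum (f ⊕ g) ⟩
  sum (f ⊕ g)     ≡⟨ ∑-distrib-+ f g ⟩
  sum f xor sum g ≡⟨ sym (cong₂ _xor_ (Σ₂≗sum f) (Σ₂≗sum g)) ⟩
  Σ₂ f xor Σ₂ g   ∎
  where open ≡-Reasoning

Σ₂-zero : {f : Fin n → Bool} → (∀ x → f x ≡ false) → Σ₂ f ≡ false
Σ₂-zero {ℕ.zero}  f≗0 = refl
Σ₂-zero {ℕ.suc n} f≗0 rewrite f≗0 zero = Σ₂-zero (f≗0 ∘ suc)

indicator : Fin n → Fin n → Bool
indicator p x = does (x ≟ p)

Σ₂-indicator : (g : Fin n → Bool) (p : Fin n) → Σ₂ (λ x → g x ∧ indicator p x) ≡ g p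
Σ₂-indicator g zero = begin
  (g zero ∧ true) xor Σ₂ (λ x → g (suc x) ∧ false)
    ≡⟨ cong₂ _xor_ (∧-identityʳ (g zero)) (Σ₂-zero (∧-zeroʳ ∘ g ∘ suc)) ⟩
  g zero xor false
    ≡⟨ xor-identityʳ (g zero) ⟩
  g zero
    ∎
  where open ≡-Reasoning
Σ₂-indicator g (suc p) =
  trans (cong (_xor Σ₂ (λ x → g (suc x) ∧ indicator p x)) (∧-zeroʳ (g zero))) (Σ₂-indicator (g ∘ suc) p)

injective⇒surjective : (s : Fin r → Fin r) → Injective _≡_ _≡_ s → ∀ t → ∃ λ l → s l ≡ t
injective⇒surjective s s-inj t with any? (λ l → s l ≟ t)
... | yes hit = hit
injective⇒surjective {ℕ.suc r} s s-inj t | no miss =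
  contradiction (injective⇒≤ s′-inj) 1+n≰n
  where
  t≢s : ∀ l → t ≢ s l
  t≢s l t≡sl = miss (l , sym t≡sl)
  s′ : Fin (ℕ.suc r) → Fin r
  s′ l = punchOut (t≢s l)
  s′-inj : Injective _≡_ _≡_ s′
  s′-inj {x} {y} = s-inj ∘ punchOut-injective (t≢s x) (t≢s y)

Σ₂-permute : (s : Fin r → Fin r) → Injective _≡_ _≡_ s → (g : Fin r → Bool) → Σ₂ (g ∘ s) ≡ Σ₂ g
Σ₂-permute {r} s s-inj g = begin
  Σ₂ (g ∘ s)  ≡⟨ Σ₂≗sum (g ∘ s) ⟩
  sum (g ∘ s) ≡⟨ sym (∑-permute g π) ⟩
  sum g       ≡⟨ sym (Σ₂≗sum g) ⟩
  Σ₂ g        ∎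
  where
  open ≡-Reasoning
  surj : ∀ t → ∃ λ l → s l ≡ t
  surj = injective⇒surjective s s-inj
  π : Permutation r r
  π = permutation s (proj₁ ∘ surj) (proj₂ ∘ surj) (λ l → s-inj (proj₂ (surj (s l))))

⟨⟩-distribˡ-⊕ : (x y z : Fin n → Bool) → ⟨ x ⊕ y , z ⟩ ≡ ⟨ x , z ⟩ xor ⟨ y , z ⟩
⟨⟩-distribˡ-⊕ x y z =
  trans (Σ₂-cong (λ j → ∧-distribʳ-xor (z j) (x j) (y j)))
        (Σ₂-distrib-⊕ (λ j → x j ∧ z j) (λ j → y j ∧ z j))

⟨⟩-distribʳ-⊕ : (x y z : Fin n → Bool) → ⟨ x , y ⊕ z ⟩ ≡ ⟨ x , y ⟩ xor ⟨ x , z ⟩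
⟨⟩-distribʳ-⊕ x y z =
  trans (Σ₂-cong (λ j → ∧-distribˡ-xor (x j) (y j) (z j)))
        (Σ₂-distrib-⊕ (λ j → x j ∧ y j) (λ j → x j ∧ z j))

xor-transpose : ∀ a b c → a xor b ≡ c → a ≡ b xor c
xor-transpose false false _ refl = refl
xor-transpose false true  _ refl = refl
xor-transpose true  false _ refl = refl
xor-transpose true  true  _ refl = refl

lincomb : (Fin k → Bool) → (Fin k → Fin n → Bool) → Fin n → Bool
lincomb c u j = Σ₂ (λ l → c l ∧ u l j)

InSpan : (Fin k → Fin n → Bool) → (Fin n → Bool) → Set
InSpan u v = ∃ λ c → v ≗ lincomb c u

record Separates (u : Fin k → Fin n → Bool) (v z : Fin n → Bool) : Set where
  constructor separating
  field
    rows⊥ : ∀ l → ⟨ u l , z ⟩ ≡ false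
    hits  : ⟨ v , z ⟩ ≡ true

separates-∷ : {u : Fin (ℕ.suc k) → Fin n → Bool} {v z : Fin n → Bool} →
              Separates (u ∘ suc) v z → ⟨ u zero , z ⟩ ≡ false → Separates u v z
separates-∷ (separating z⊥u vz) u₀z = separating (λ { zero → u₀z ; (suc l) → z⊥u l }) vz

-- Depending on ⟨ u₀ , z′ ⟩, either z′ or z ⊕ z′ separates v from all of u.
separates-step : (u : Fin (ℕ.suc k) → Fin n → Bool) (v z z′ : Fin n → Bool) →
                 Separates (u ∘ suc) v z → ⟨ u zero , z ⟩ ≡ true →
                 Separates (u ∘ suc) (v ⊕ u zero) z′ → ∃ (Separates u v)
separates-step u v z z′ (separating z⊥u vz) u₀z (separating z′⊥u v⊕u₀z′)
  with ⟨ u zero , z′ ⟩ in u₀z′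
     | xor-transpose ⟨ v , z′ ⟩ ⟨ u zero , z′ ⟩ true (trans (sym (⟨⟩-distribˡ-⊕ v (u zero) z′)) v⊕u₀z′)
... | false | vz′ = z′ , separates-∷ (separating z′⊥u vz′) u₀z′
... | true  | vz′ = z ⊕ z′ , separates-∷ (separating z⊕z′⊥u vz⊕z′) u₀z⊕z′
  where
  z⊕z′⊥u : ∀ l → ⟨ u (suc l) , z ⊕ z′ ⟩ ≡ false
  z⊕z′⊥u l = trans (⟨⟩-distribʳ-⊕ (u (suc l)) z z′) (cong₂ _xor_ (z⊥u l) (z′⊥u l))
  vz⊕z′ : ⟨ v , z ⊕ z′ ⟩ ≡ true
  vz⊕z′ = trans (⟨⟩-distribʳ-⊕ v z z′) (cong₂ _xor_ vz vz′)
  u₀z⊕z′ : ⟨ u zero , z ⊕ z′ ⟩ ≡ false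
  u₀z⊕z′ = trans (⟨⟩-distribʳ-⊕ (u zero) z z′) (cong₂ _xor_ u₀z u₀z′)

inSpan⊎separable : (u : Fin k → Fin n → Bool) (v : Fin n → Bool) → InSpan u v ⊎ ∃ (Separates u v)
inSpan⊎separable {ℕ.zero} u v with any? (λ j → v j Bool.≟ true)
... | yes (p , vp) = inj₂ (indicator p , separating (λ ()) (trans (Σ₂-indicator v p) vp))
... | no v≢0 = inj₁ ((λ ()) , λ j → ¬-not (λ vj → v≢0 (j , vj)))
inSpan⊎separable {ℕ.suc k} u v with inSpan⊎separable (u ∘ suc) v
... | inj₁ (c , v≗c·u) = inj₁ (false ∷ c , v≗c·u)
... | inj₂ (z , sep) with ⟨ u zero , z ⟩ in u₀z
...   | false = inj₂ (z , separates-∷ sep u₀z)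
...   | true with inSpan⊎separable (u ∘ suc) (v ⊕ u zero)
...     | inj₁ (c , v⊕u₀≗c·u) = inj₁ (true ∷ c , λ j → xor-transpose (v j) (u zero j) _ (v⊕u₀≗c·u j))
...     | inj₂ (z′ , sep′) = inj₂ (separates-step u v z z′ sep u₀z sep′)

Exhaustible : Set → Set₁
Exhaustible A = {P : Pred A 0ℓ} → Decidable P → Dec (∃ P)

any?-Bool : Exhaustible Bool
any?-Bool P? with P? true | P? false
... | yes pt | _      = yes (true , pt)
... | no _   | yes pf = yes (false , pf)
... | no ¬pt | no ¬pf = no λ { (true , pt) → ¬pt pt ; (false , pf) → ¬pf pf }

any?-→ : {A : Set} → Exhaustible A → {P : Pred (Fin k → A) 0ℓ} →
         P Respects _≗_ → Decidable P → Dec (∃ P)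
any?-→ {ℕ.zero} any?-A resp P? with P? (λ ())
... | yes p = yes ((λ ()) , p)
... | no ¬p = no λ (f , pf) → ¬p (resp (λ ()) pf)
any?-→ {ℕ.suc k} any?-A resp P? with any?-A (λ a → any?-→ any?-A (resp ∘ ∷-cong a) (P? ∘ (a ∷_)))
  where
  ∷-cong : ∀ a {f g} → f ≗ g → (a ∷ f) ≗ (a ∷ g)
  ∷-cong a f≗g zero    = refl
  ∷-cong a f≗g (suc x) = f≗g x
... | yes (a , g , p) = yes (a ∷ g , p)
... | no ¬p = no λ (f , pf) → ¬p (f zero , f ∘ suc , resp (λ { zero → refl ; (suc x) → refl }) pf)

all?-→ : {A : Set} → Exhaustible A → {P : Pred (Fin k → A) 0ℓ} →
         P Respects _≗_ → Decidable P → Dec (∀ f → P f)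
all?-→ any?-A resp P? with any?-→ any?-A (λ f≗g ¬pf pg → ¬pf (resp (sym ∘ f≗g) pg)) (¬? ∘ P?)
... | yes (f , ¬pf) = no λ all-p → ¬pf (all-p f)
... | no ¬∃¬p = yes λ f → decidable-stable (P? f) (λ ¬pf → ¬∃¬p (f , ¬pf))

max-of-bounded : {P : Pred ℕ 0ℓ} → Decidable P → P 0 → (b : ℕ) → (∀ m → P m → m ≤ b) →
          ∃ λ k → P k × (∀ m → P m → m ≤ k)
max-of-bounded P? p₀ b bound with P? b
... | yes pb = b , pb , bound
max-of-bounded P? p₀ ℕ.zero    bound | no ¬pb = contradiction p₀ ¬pb
max-of-bounded P? p₀ (ℕ.suc b) bound | no ¬pb = max-of-bounded P? p₀ b λ m pm →
  ≤-pred (≤∧≢⇒< (bound m pm) λ { refl → ¬pb pm })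

injective? : (s : Fin k → Fin r) → Dec (Injective _≡_ _≡_ s)
injective? s with all? (λ x → all? (λ y → (s x ≟ s y) →-dec (x ≟ y)))
... | yes inj = yes λ {x} {y} → inj x y
... | no ¬inj = no λ inj → ¬inj λ x y → inj

module _ {r n : ℕ} (M : BMatrix r n) where

  rowsIndependent? : (s : Fin k → Fin r) → Dec (RowsIndependent M s)
  rowsIndependent? s = all?-→ any?-Bool
    (λ c≗c′ indep dep l → trans (sym (c≗c′ l))
       (indep (λ j → trans (Σ₂-cong (λ l → cong (_∧ M (s l) j) (c≗c′ l))) (dep j)) l))
    (λ c → all? (λ j → lincomb c (M ∘ s) j Bool.≟ false) →-dec all? (λ l → c l Bool.≟ false))

  hasIndepRows? : ∀ k → Dec (HasIndepRows M k)
  hasIndepRows? k = any?-→ any?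
    (λ s≗s′ (s-inj , indep) →
       (λ {x} {y} eq → s-inj (trans (s≗s′ x) (trans eq (sym (s≗s′ y))))) ,
       (λ c dep → indep c (λ j → trans (Σ₂-cong (λ l → cong (λ t → c l ∧ M t j) (s≗s′ l))) (dep j))))
    (λ s → injective? s ×-dec rowsIndependent? s)

  rank : ∃ (IsRank M)
  rank = max-of-bounded hasIndepRows? ((λ ()) , (λ { {()} }) , λ _ _ ()) r
           (λ m (s , s-inj , _) → injective⇒≤ s-inj)

  hasIndepRows⇒rowsIndependent : HasIndepRows M r → RowsIndependent M id
  hasIndepRows⇒rowsIndependent (s , s-inj , indep) c dep t with injective⇒surjective s s-inj t
  ... | l , refl = indep (c ∘ s) (λ j → trans (Σ₂-permute s s-inj (λ t → c t ∧ M t j)) (dep j)) l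

  rowInSpan⇒¬rowsIndependent : (e : Fin r → Bool) (i : Fin r) → e i ≡ false →
                               M i ≗ lincomb e M → ¬ RowsIndependent M id
  rowInSpan⇒¬rowsIndependent e i eᵢ≡0 Mᵢ≗e·M indep = contradiction (indep w w·M≗0 i) wᵢ≢0
    where
    w : Fin r → Bool
    w = e ⊕ indicator i
    wᵢ≢0 : w i ≢ false
    wᵢ≢0 rewrite eᵢ≡0 | dec-true (i ≟ i) refl = λ ()
    w·M≗0 : ∀ j → lincomb w M j ≡ false
    w·M≗0 j = begin
      lincomb w M j
        ≡⟨ Σ₂-cong (λ t → ∧-distribʳ-xor (M t j) (e t) (indicator i t)) ⟩
      Σ₂ (λ t → (e t ∧ M t j) xor (indicator i t ∧ M t j))
        ≡⟨ Σ₂-distrib-⊕ (λ t → e t ∧ M t j) (λ t → indicator i t ∧ M t j) ⟩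
      lincomb e M j xor Σ₂ (λ t → indicator i t ∧ M t j)
        ≡⟨ cong (lincomb e M j xor_) (Σ₂-cong (λ t → ∧-comm (indicator i t) (M t j))) ⟩
      lincomb e M j xor Σ₂ (λ t → M t j ∧ indicator i t)
        ≡⟨ cong₂ _xor_ (sym (Mᵢ≗e·M j)) (Σ₂-indicator (λ t → M t j) i) ⟩
      M i j xor M i j
        ≡⟨ xor-same (M i j) ⟩
      false
        ∎
      where open ≡-Reasoning

minRank⇒rowsIndependent : {A : PMatrix r n} → IsMinRank A r →
                          {C : BMatrix r n} → IsCompletion A C → RowsIndependent C id
minRank⇒rowsIndependent {r} (_ , minimal) {C} C-completes with rank C
... | K , K-rank@(K-indep@(s , s-inj , _) , _) =
  hasIndepRows⇒rowsIndependent C (subst (HasIndepRows C) K≡r K-indep)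
  where
  K≡r : K ≡ r
  K≡r = ≤-antisym (injective⇒≤ s-inj) (minimal C C-completes K K-rank)

agreement⇒completion : (A : PMatrix r n) (C : BMatrix r n) →
                       (∀ t j → starIndicator A t j ≡ false → C t j ≡ zeroStars A t j) → IsCompletion A C
agreement⇒completion A C agree t j with A t j | agree t j
... | 𝟘 | agreeₜⱼ = agreeₜⱼ refl
... | 𝟙 | agreeₜⱼ = agreeₜⱼ refl
... | ⋆ | _       = tt

infixl 7 _∧̇_
_∧̇_ : (x y : Fin n → Bool) → Fin n → Bool
(x ∧̇ y) j = x j ∧ y j

⟨⟩-∧̇ : (x m z : Fin n → Bool) → ⟨ x , m ∧̇ z ⟩ ≡ ⟨ x ∧̇ m , z ⟩
⟨⟩-∧̇ x m z = Σ₂-cong (λ j → sym (∧-assoc (x j) (m j) (z j)))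

module IsolatingRow {r n : ℕ} (A : PMatrix r n) (i : Fin r) where

  a : BMatrix r n
  a = zeroStars A

  unstarred : Fin n → Bool
  unstarred j = not (starIndicator A i j)

  below : Fin r → Bool
  below t = does (t <? i)

  earlierRows : Fin r → Fin n → Bool
  earlierRows t j = below t ∧ (a t ∧̇ unstarred) j

  IsolatingVector : (Fin n → Bool) → Set
  IsolatingVector z = (∀ j → D_apply A i z j ≡ false) × (⟨ a i , z ⟩ ≡ true) ×
                      (∀ t → t < i → ⟨ a t , z ⟩ ≡ false)

  separator⇒isolatingVector : {z : Fin n → Bool} → Separates earlierRows (a i ∧̇ unstarred) z →
                              IsolatingVector (unstarred ∧̇ z)
  separator⇒isolatingVector {z} (separating earlier⊥z ownRow·z) =
    (λ j → trans (sym (∧-assoc (starIndicator A i j) _ (z j)))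
                 (cong (_∧ z j) (∧-inverseʳ (starIndicator A i j)))) ,
    trans (⟨⟩-∧̇ (a i) unstarred z) ownRow·z ,
    λ t t<i → trans (⟨⟩-∧̇ (a t) unstarred z) (unmask t t<i (earlier⊥z t))
    where
    unmask : ∀ t → t < i → ⟨ earlierRows t , z ⟩ ≡ false → ⟨ a t ∧̇ unstarred , z ⟩ ≡ false
    unmask t t<i rewrite dec-true (t <? i) t<i = id

  inSpan⇒dependentCompletion : InSpan earlierRows (a i ∧̇ unstarred) →
                               ∃ λ C → IsCompletion A C × ¬ RowsIndependent C id
  inSpan⇒dependentCompletion (c , ownRow≗c·earlier) =
    C , agreement⇒completion A C agree , rowInSpan⇒¬rowsIndependent C e i eᵢ≡0 Cᵢ≗e·C
    where
    e : Fin r → Bool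
    e t = c t ∧ below t
    C : BMatrix r n
    C = updateAt a i (λ _ → lincomb e a)
    eᵢ≡0 : e i ≡ false
    eᵢ≡0 rewrite dec-false (i <? i) (<-irrefl refl) = ∧-zeroʳ (c i)
    e·C≗e·a : ∀ j t → e t ∧ C t j ≡ e t ∧ a t j
    e·C≗e·a j t with t ≟ i
    ... | yes refl rewrite eᵢ≡0 = refl
    ... | no t≢i = cong (λ row → e t ∧ row j) (updateAt-minimal t i a t≢i)
    Cᵢ≗e·C : C i ≗ lincomb e C
    Cᵢ≗e·C j = trans (cong (_$ j) (updateAt-updates i a)) (sym (Σ₂-cong (e·C≗e·a j)))
    agreeᵢ : ∀ j → starIndicator A i j ≡ false → lincomb e a j ≡ a i j
    agreeᵢ j starᵢⱼ≡0 = begin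
      lincomb e a j
        ≡⟨ Σ₂-cong (λ t → ∧-assoc (c t) (below t) (a t j)) ⟩
      Σ₂ (λ t → c t ∧ (below t ∧ a t j))
        ≡⟨ Σ₂-cong (λ t → cong (λ x → c t ∧ (below t ∧ x)) (sym (unmask t))) ⟩
      lincomb c earlierRows j
        ≡⟨ sym (ownRow≗c·earlier j) ⟩
      a i j ∧ unstarred j
        ≡⟨ unmask i ⟩
      a i j
        ∎
      where
      open ≡-Reasoning
      unmask : ∀ t → a t j ∧ unstarred j ≡ a t j
      unmask t = trans (cong (λ s → a t j ∧ not s) starᵢⱼ≡0) (∧-identityʳ (a t j))
    agree : ∀ t j → starIndicator A t j ≡ false → C t j ≡ a t j
    agree t j with t ≟ i
    ... | yes refl = trans (cong (_$ j) (updateAt-updates i a)) ∘ agreeᵢ j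
    ... | no t≢i = λ _ → cong (_$ j) (updateAt-minimal t i a t≢i)

  isolatingVector : IsMinRank A r → ∃ IsolatingVector
  isolatingVector minRank with inSpan⊎separable earlierRows (a i ∧̇ unstarred)
  ... | inj₁ inSpan =
    let _ , C-completes , ¬indep = inSpan⇒dependentCompletion inSpan
    in  ⊥-elim (¬indep (minRank⇒rowsIndependent minRank C-completes))
  ... | inj₂ (z , separates) = unstarred ∧̇ z , separator⇒isolatingVector separates

lemma12 : (r n : ℕ) (A : PMatrix r n) → IsMinRank A r → Isolated A
lemma12 r n A minRank = proj₁ ∘ isolating , proj₂ ∘ isolating
  where
  isolating : ∀ i → ∃ (IsolatingRow.IsolatingVector A i)
  isolating i = IsolatingRow.isolatingVector A i minRank
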